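{- Let $P_k$ be an induced path on $k\ge 3$ vertices of a graph $G$ with endpoints $x$ and $y$. Then $P_k$ is an avoidable path in $G$ if and only if $xy$ is an avoidable edge in the graph $G+xy-I[P_k]$.
   Context: All graphs are finite, simple and undirected. $P_k$ denotes an induced path on $k$ vertices; its endpoints are its two vertices of degree one, and its internal path is the path obtained by removing its endpoints, with vertex set $in(P_k)$. $I[P_k]=N_G[in(P_k)]\setminus\{x,y\}$, where for a set $S$, $N_G[S]$ is $S$ together with all vertices having a neighbor in $S$. For non-adjacent $x,y$, $G+xy$ is $G$ with the edge $xy$ added. An induced path $P_k$ ($k\ge2$) is simplicial if no induced path on $k+2$ vertices contains $P_k$ as its internal path, and avoidable if either it is simplicial or every induced path on $k+2$ vertices containing $P_k$ as its internal path is contained in an induced cycle. An edge is avoidable if it is avoidable as an induced path on two vertices, i.e., either no induced path on four vertices has it as middle edge, or every such path is contained in an induced cycle. -}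

module Defs where

open import Data.Nat using (ℕ; zero; suc; _≤_; _<_; _+_)
open import Data.Fin using (Fin; toℕ)
open import Data.Vec using (Vec; _∷_; []; _++_; lookup; head; last)
open import Data.Product using (Σ; ∃; _×_; _,_)
open import Data.Sum using (_⊎_)
open import Data.Empty using (⊥)
open import Relation.Nullary using (¬_)
open import Relation.Binary.PropositionalEquality using (_≡_; _≢_)

-- A graph whose vertex set is a subset V of Fin n, with adjacency relation E.
-- (Using a vertex subset lets vertex deletion stay inside the same type.)
record Graph (n : ℕ) : Set₁ where
  constructor mkGraph
  field
    V : Fin n → Set
    E : Fin n → Fin n → Set
open Graph public

record IsSimple {n : ℕ} (G : Graph n) : Set where
  field
    E-sym   : ∀ {u v} → E G u v → E G v u
    E-irr   : ∀ {u} → ¬ E G u u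
    E-V     : ∀ {u v} → E G u v → V G u

Consec : ∀ {l} → Fin l → Fin l → Set
Consec i j = suc (toℕ i) ≡ toℕ j ⊎ suc (toℕ j) ≡ toℕ i

CSucc : ∀ {m} → Fin m → Fin m → Set
CSucc {m} i j = suc (toℕ i) ≡ toℕ j ⊎ (suc (toℕ i) ≡ m × toℕ j ≡ 0)

CycConsec : ∀ {m} → Fin m → Fin m → Set
CycConsec i j = CSucc i j ⊎ CSucc j i

IsInducedPath : ∀ {n l} → Graph n → Vec (Fin n) l → Set
IsInducedPath G p =
  (∀ i → V G (lookup p i)) ×
  (∀ i j → lookup p i ≡ lookup p j → i ≡ j) ×
  (∀ i j → (E G (lookup p i) (lookup p j) → Consec i j)
         × (Consec i j → E G (lookup p i) (lookup p j)))

IsInducedCycle : ∀ {n m} → Graph n → Vec (Fin n) m → Set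
IsInducedCycle {m = m} G c =
  3 ≤ m ×
  (∀ i → V G (lookup c i)) ×
  (∀ i j → lookup c i ≡ lookup c j → i ≡ j) ×
  (∀ i j → (E G (lookup c i) (lookup c j) → CycConsec i j)
         × (CycConsec i j → E G (lookup c i) (lookup c j)))

PathInCycle : ∀ {n l m} → Vec (Fin n) l → Vec (Fin n) m → Set
PathInCycle {m = m} q c =
  (∀ i → Σ (Fin m) λ j → lookup c j ≡ lookup q i) ×
  (∀ i i' → Consec i i' →
     Σ (Fin m) λ j → Σ (Fin m) λ j' →
       lookup c j ≡ lookup q i × lookup c j' ≡ lookup q i' × CycConsec j j')

InInducedCycle : ∀ {n l} → Graph n → Vec (Fin n) l → Set
InInducedCycle {n} G q =
  Σ ℕ λ m → Σ (Vec (Fin n) m) λ c → IsInducedCycle G c × PathInCycle q c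

ext : ∀ {n k} → Fin n → Vec (Fin n) k → Fin n → Vec (Fin n) (suc (k + 1))
ext a p b = a ∷ (p ++ (b ∷ []))

-- (Every induced P_{k+2} whose internal path is P, in either orientation,
-- is, up to reversal, of the form ext a p b.)
Simplicial : ∀ {n k} → Graph n → Vec (Fin n) k → Set
Simplicial {n} G p = ¬ (Σ (Fin n) λ a → Σ (Fin n) λ b → IsInducedPath G (ext a p b))

Avoidable : ∀ {n k} → Graph n → Vec (Fin n) k → Set
Avoidable {n} G p =
  Simplicial G p ⊎
  (∀ (a b : Fin n) → IsInducedPath G (ext a p b) → InInducedCycle G (ext a p b))

AvoidableEdge : ∀ {n} → Graph n → Fin n → Fin n → Set
AvoidableEdge G x y = Avoidable G (x ∷ y ∷ [])

Internal : ∀ {n l} → Vec (Fin n) l → Fin n → Set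
Internal {l = l} p v = Σ (Fin l) λ i → 1 ≤ toℕ i × suc (toℕ i) < l × lookup p i ≡ v

NClosed : ∀ {n} → Graph n → (Fin n → Set) → Fin n → Set
NClosed {n} G S v = S v ⊎ (Σ (Fin n) λ u → S u × E G u v)

IP : ∀ {n l} → Graph n → Vec (Fin n) (suc l) → Fin n → Set
IP G p v = NClosed G (Internal p) v × v ≢ head p × v ≢ last p

addEdge : ∀ {n} → Graph n → Fin n → Fin n → Graph n
addEdge G x y = mkGraph (V G) (λ u v → E G u v ⊎ (u ≡ x × v ≡ y) ⊎ (u ≡ y × v ≡ x))

delete : ∀ {n} → Graph n → (Fin n → Set) → Graph n
delete G S = mkGraph (λ v → V G v × ¬ S v)
                     (λ u v → (V G u × ¬ S u) × (V G v × ¬ S v) × E G u v)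

G+xy-I : ∀ {n l} → Graph n → Vec (Fin n) (suc l) → Graph n
G+xy-I G p = delete (addEdge G (head p) (last p)) (IP G p)

-- Fix ends a, b. Since I[P] consists of the internal vertices of P and their neighbours other
-- than x and y, the vertices of G' = G + xy - I[P] besides x and y are exactly those of G that
-- are off P and have no neighbour inside P. Hence a, P, b is an induced path of G iff a, x, y, b
-- is one of G'. An induced cycle through a, P, b is that path followed by a closing path from b
-- back to a whose vertices see P only at its two ends, so they survive in G', and the same
-- closing path closes a, x, y, b into an induced cycle of G' (and conversely). Thus the two
-- clauses of avoidability, simpliciality and "every extension lies on an induced cycle",
-- correspond one to one. Cycles are handled as maps on positions, rotated and possibly
-- reflected so that the path they contain occupies their first positions.

module Submission where

open import Defs
open import Data.Nat using (ℕ; zero; suc; _+_; _∸_; _≤_; _<_; z≤n; s≤s; _<?_)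
open import Data.Nat.Properties
open import Data.Fin as Fin using (Fin; toℕ; fromℕ<; inject≤)
open import Data.Fin.Properties using (toℕ<n; toℕ-fromℕ<; toℕ-injective; toℕ-inject≤)
open import Data.Vec using (Vec; []; _∷_; head; last; lookup; tabulate; _++_)
open import Data.Vec.Properties using (lookup∘tabulate)
open import Data.Product using (Σ; _×_; _,_; proj₁; proj₂)
open import Data.Sum as Sum using (_⊎_; inj₁; inj₂)
open import Data.Sum.Function.Propositional using (_⊎-⇔_)
open import Data.Product.Function.NonDependent.Propositional using (_×-⇔_)
open import Data.Empty using (⊥-elim)
open import Function.Bundles using (_⇔_; mk⇔; Equivalence)
import Function.Properties.Equivalence as ⇔
open import Relation.Nullary using (¬_; yes; no)
open import Relation.Binary.PropositionalEquality
open import Function.Base using (_∘_)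

open Equivalence using (to; from)

⇔-swap : ∀ {A B : Set} → (A ⊎ B) ⇔ (B ⊎ A)
⇔-swap = mk⇔ Sum.swap Sum.swap

lookupOr : ∀ {A : Set} {L} → A → Vec A L → ℕ → A
lookupOr d []       i       = d
lookupOr d (x ∷ xs) zero    = x
lookupOr d (x ∷ xs) (suc i) = lookupOr d xs i

lookup≡lookupOr : ∀ {A : Set} {L} (d : A) (v : Vec A L) (i : Fin L) → lookup v i ≡ lookupOr d v (toℕ i)
lookup≡lookupOr d (x ∷ v) Fin.zero    = refl
lookup≡lookupOr d (x ∷ v) (Fin.suc i) = lookup≡lookupOr d v i

lookupOr-++ˡ : ∀ {A : Set} {L L'} (d : A) (u : Vec A L) (w : Vec A L') i → i < L →
               lookupOr d (u ++ w) i ≡ lookupOr d u i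
lookupOr-++ˡ d (x ∷ u) w zero    _       = refl
lookupOr-++ˡ d (x ∷ u) w (suc i) (s≤s h) = lookupOr-++ˡ d u w i h

lookupOr-++ʳ : ∀ {A : Set} {L L'} (d : A) (u : Vec A L) (w : Vec A L') i →
               lookupOr d (u ++ w) (L + i) ≡ lookupOr d w i
lookupOr-++ʳ d []      w i = refl
lookupOr-++ʳ d (x ∷ u) w i = lookupOr-++ʳ d u w i

head≡lookupOr : ∀ {A : Set} {L} (d : A) (v : Vec A (suc L)) → head v ≡ lookupOr d v 0
head≡lookupOr d (x ∷ v) = refl

last≡lookupOr : ∀ {A : Set} {L} (d : A) (v : Vec A (suc L)) → last v ≡ lookupOr d v L
last≡lookupOr {L = zero}  d (x ∷ []) = refl
last≡lookupOr {L = suc L} d (x ∷ v)  = last≡lookupOr d v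


Adjacent : ℕ → ℕ → Set
Adjacent i j = suc i ≡ j ⊎ suc j ≡ i

CycSucc : ℕ → ℕ → ℕ → Set
CycSucc M i j = suc i ≡ j ⊎ (suc i ≡ M × j ≡ 0)

CycAdjacent : ℕ → ℕ → ℕ → Set
CycAdjacent M i j = CycSucc M i j ⊎ CycSucc M j i

Adjacent-sym : ∀ {i j} → Adjacent i j ⇔ Adjacent j i
Adjacent-sym = ⇔-swap

Adjacent-suc : ∀ {i j} → Adjacent i j ⇔ Adjacent (suc i) (suc j)
Adjacent-suc = mk⇔ (Sum.map (cong suc) (cong suc)) (Sum.map suc-injective suc-injective)

record InducedOn {n} (H : Graph n) (L : ℕ) (q : ℕ → Fin n) (R : ℕ → ℕ → Set) : Set where
  constructor induced
  field
    vertex    : ∀ i → i < L → V H (q i)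
    injective : ∀ i j → i < L → j < L → q i ≡ q j → i ≡ j
    edge      : ∀ i j → i < L → j < L → E H (q i) (q j) ⇔ R i j

InducedCycleOn : ∀ {n} → Graph n → ℕ → (ℕ → Fin n) → Set
InducedCycleOn H M f = 3 ≤ M × InducedOn H M f (CycAdjacent M)

-- IsInducedPath G v is InducedVec G v Adjacent and IsInducedCycle G c is
-- 3 ≤ m × InducedVec G c (CycAdjacent m), definitionally.
InducedVec : ∀ {n L} → Graph n → Vec (Fin n) L → (ℕ → ℕ → Set) → Set
InducedVec {L = L} H v R =
  (∀ i → V H (lookup v i)) ×
  (∀ i j → lookup v i ≡ lookup v j → i ≡ j) ×
  (∀ (i j : Fin L) → (E H (lookup v i) (lookup v j) → R (toℕ i) (toℕ j))
                   × (R (toℕ i) (toℕ j) → E H (lookup v i) (lookup v j)))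

InducedVec⇒InducedOn : ∀ {n L} {H : Graph n} {R : ℕ → ℕ → Set} (d : Fin n) (v : Vec (Fin n) L) →
                        InducedVec H v R → InducedOn H L (lookupOr d v) R
InducedVec⇒InducedOn {L = L} {H} {R} d v (hV , hI , hE) = induced vertex injective edge
  where
  lookupOr≡lookup : ∀ i (h : i < L) → lookupOr d v i ≡ lookup v (fromℕ< h)
  lookupOr≡lookup i h = trans (cong (lookupOr d v) (sym (toℕ-fromℕ< h))) (sym (lookup≡lookupOr d v (fromℕ< h)))
  vertex : ∀ i → i < L → V H (lookupOr d v i)
  vertex i h = subst (V H) (sym (lookupOr≡lookup i h)) (hV _)
  injective : ∀ i j → i < L → j < L → lookupOr d v i ≡ lookupOr d v j → i ≡ j
  injective i j hi hj e = begin
    i                  ≡⟨ toℕ-fromℕ< hi ⟨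
    toℕ (fromℕ< hi)    ≡⟨ cong toℕ (hI _ _ (trans (sym (lookupOr≡lookup i hi))
                                            (trans e (lookupOr≡lookup j hj)))) ⟩
    toℕ (fromℕ< hj)    ≡⟨ toℕ-fromℕ< hj ⟩
    j                  ∎
    where open ≡-Reasoning
  edge : ∀ i j → i < L → j < L → E H (lookupOr d v i) (lookupOr d v j) ⇔ R i j
  edge i j hi hj rewrite lookupOr≡lookup i hi | lookupOr≡lookup j hj =
    subst₂ (λ a b → E H (lookup v (fromℕ< hi)) (lookup v (fromℕ< hj)) ⇔ R a b) (toℕ-fromℕ< hi) (toℕ-fromℕ< hj)
      (mk⇔ (proj₁ (hE _ _)) (proj₂ (hE _ _)))

InducedOn⇒InducedVec : ∀ {n L} {H : Graph n} {R : ℕ → ℕ → Set} (g : ℕ → Fin n) (v : Vec (Fin n) L) →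
                        (∀ i → lookup v i ≡ g (toℕ i)) → InducedOn H L g R → InducedVec H v R
InducedOn⇒InducedVec {H = H} g v v≡g (induced vertex injective edge) =
  (λ i → subst (V H) (sym (v≡g i)) (vertex _ (toℕ<n i))) ,
  (λ i j e → toℕ-injective (injective _ _ (toℕ<n i) (toℕ<n j) (trans (sym (v≡g i)) (trans e (v≡g j))))) ,
  λ i j → let e = edge-at i j in to e , from e
  where
  edge-at : ∀ i j → E H (lookup v i) (lookup v j) ⇔ _
  edge-at i j rewrite v≡g i | v≡g j = edge _ _ (toℕ<n i) (toℕ<n j)

Occurs : ∀ {n} → ℕ → (ℕ → Fin n) → ℕ → (ℕ → Fin n) → Set
Occurs L q M f = ∀ i → i < L → Σ ℕ λ j → j < M × f j ≡ q i

InInducedCycle⇒InducedCycleOn : ∀ {n L} {H : Graph n} (d : Fin n) (v : Vec (Fin n) L) → InInducedCycle H v →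
  Σ ℕ λ M → Σ (ℕ → Fin n) λ f → InducedCycleOn H M f × Occurs L (lookupOr d v) M f
InInducedCycle⇒InducedCycleOn d v (M , c , (3≤M , c-induced) , c∋v , _) =
  M , lookupOr d c , (3≤M , InducedVec⇒InducedOn d c c-induced) , occurs
  where
  occurs : Occurs _ (lookupOr d v) M (lookupOr d c)
  occurs i h = let (j , cj≡vi) = c∋v (fromℕ< h) in
    toℕ j , toℕ<n j ,
    trans (sym (lookup≡lookupOr d c j))
      (trans cj≡vi (trans (lookup≡lookupOr d v _) (cong (lookupOr d v) (toℕ-fromℕ< h))))

InducedCycleOn⇒InInducedCycle : ∀ {n L M} {H : Graph n} (d : Fin n) (v : Vec (Fin n) L) (f : ℕ → Fin n) →
  InducedCycleOn H M f → L ≤ M → (∀ i → i < L → f i ≡ lookupOr d v i) → InInducedCycle H v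
InducedCycleOn⇒InInducedCycle {L = L} {M} d v f (3≤M , f-induced) L≤M f≡v =
  M , c , (3≤M , InducedOn⇒InducedVec f c (lookup∘tabulate _) f-induced) , v⊆c , edges
  where
  c = tabulate (f ∘ toℕ)
  pos : Fin L → Fin M
  pos i = inject≤ i L≤M
  c-pos : ∀ i → lookup c (pos i) ≡ lookup v i
  c-pos i = trans (lookup∘tabulate _ (pos i)) (trans (cong f (toℕ-inject≤ i L≤M))
              (trans (f≡v _ (toℕ<n i)) (sym (lookup≡lookupOr d v i))))
  v⊆c : ∀ i → Σ (Fin M) λ j → lookup c j ≡ lookup v i
  v⊆c i = pos i , c-pos i
  edges : ∀ i i' → Consec i i' → Σ (Fin M) λ j → Σ (Fin M) λ j' →
          lookup c j ≡ lookup v i × lookup c j' ≡ lookup v i' × CycConsec j j'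
  edges i i' adj = pos i , pos i' , c-pos i , c-pos i' ,
    subst₂ (CycAdjacent M) (sym (toℕ-inject≤ i L≤M)) (sym (toℕ-inject≤ i' L≤M))
      (Sum.map inj₁ inj₁ adj)

-- Symmetries of a cycle

record CycleSymmetry (M : ℕ) (σ : ℕ → ℕ) : Set where
  field
    range      : ∀ i → i < M → σ i < M
    injective  : ∀ i j → i < M → j < M → σ i ≡ σ j → i ≡ j
    surjective : ∀ j → j < M → Σ ℕ λ i → i < M × σ i ≡ j
    adjacent   : ∀ i j → i < M → j < M → CycAdjacent M (σ i) (σ j) ⇔ CycAdjacent M i j

CycleSymmetry-∘ : ∀ {M σ τ} → CycleSymmetry M σ → CycleSymmetry M τ → CycleSymmetry M (σ ∘ τ)
CycleSymmetry-∘ {M} {σ} {τ} sσ sτ = record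
  { range      = λ i h → S.range _ (T.range i h)
  ; injective  = λ i j hi hj e → T.injective i j hi hj (S.injective _ _ (T.range i hi) (T.range j hj) e)
  ; surjective = surjective
  ; adjacent   = λ i j hi hj → ⇔.trans (S.adjacent _ _ (T.range i hi) (T.range j hj)) (T.adjacent i j hi hj)
  }
  where
  module S = CycleSymmetry sσ
  module T = CycleSymmetry sτ
  surjective : ∀ k → k < M → Σ ℕ λ i → i < M × σ (τ i) ≡ k
  surjective k h = let (j , hj , σj≡k) = S.surjective k h ; (i , hi , τi≡j) = T.surjective j hj in
    i , hi , trans (cong σ τi≡j) σj≡k

relabel-cycle : ∀ {n M σ} {H : Graph n} {f : ℕ → Fin n} → CycleSymmetry M σ →
                InducedCycleOn H M f → InducedCycleOn H M (f ∘ σ)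
relabel-cycle sσ (3≤M , induced vertex injective edge) = 3≤M , induced
  (λ i h → vertex _ (range i h))
  (λ i j hi hj e → S.injective i j hi hj (injective _ _ (range i hi) (range j hj) e))
  (λ i j hi hj → ⇔.trans (edge _ _ (range i hi) (range j hj)) (S.adjacent i j hi hj))
  where
  module S = CycleSymmetry sσ
  open S using (range)

relabel-Occurs : ∀ {n L M σ} {f q : ℕ → Fin n} → CycleSymmetry M σ → Occurs L q M f → Occurs L q M (f ∘ σ)
relabel-Occurs {f = f} sσ occ i h =
  let (j , hj , fj≡qi) = occ i h ; (k , hk , σk≡j) = CycleSymmetry.surjective sσ j hj in
  k , hk , trans (cong f σk≡j) fj≡qi

CycSucc-preserved⇒CycAdjacent : ∀ {M} (σ : ℕ → ℕ) →
  (∀ i j → i < M → j < M → CycSucc M (σ i) (σ j) ⇔ CycSucc M i j) →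
  ∀ i j → i < M → j < M → CycAdjacent M (σ i) (σ j) ⇔ CycAdjacent M i j
CycSucc-preserved⇒CycAdjacent σ h i j hi hj = h i j hi hj ⊎-⇔ h j i hj hi

CycSucc-reversed⇒CycAdjacent : ∀ {M} (σ : ℕ → ℕ) →
  (∀ i j → i < M → j < M → CycSucc M (σ i) (σ j) ⇔ CycSucc M j i) →
  ∀ i j → i < M → j < M → CycAdjacent M (σ i) (σ j) ⇔ CycAdjacent M i j
CycSucc-reversed⇒CycAdjacent σ h i j hi hj = ⇔.trans (h i j hi hj ⊎-⇔ h j i hj hi) ⇔-swap

rotate₁ : ℕ → ℕ → ℕ
rotate₁ M i with suc i <? M
... | yes _ = suc i
... | no  _ = 0

rotate₁-< : ∀ M i → suc i < M → rotate₁ M i ≡ suc i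
rotate₁-< M i h with suc i <? M
... | yes _ = refl
... | no ¬h = ⊥-elim (¬h h)

rotate₁-≡ : ∀ M i → suc i ≡ M → rotate₁ M i ≡ 0
rotate₁-≡ M i h with suc i <? M
... | yes h' = ⊥-elim (<-irrefl h h')
... | no  _  = refl

last-index : ∀ {M} → 0 < M → Σ ℕ λ i → suc i ≡ M
last-index (s≤s {n = i} _) = i , refl

3≤⇒1≢ : ∀ {M} → 3 ≤ M → 1 ≢ M
3≤⇒1≢ (s≤s ()) refl

rotate₁-CycSucc : ∀ M → 3 ≤ M → ∀ i j → i < M → j < M →
                  CycSucc M (rotate₁ M i) (rotate₁ M j) ⇔ CycSucc M i j
rotate₁-CycSucc M 3≤M i j hi hj with m≤n⇒m<n∨m≡n hi | m≤n⇒m<n∨m≡n hj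
... | inj₁ a | inj₁ b rewrite rotate₁-< M i a | rotate₁-< M j b = mk⇔
  (λ { (inj₁ e) → inj₁ (suc-injective e) ; (inj₂ (_ , ())) })
  (λ { (inj₁ e) → inj₁ (cong suc e) ; (inj₂ (e , _)) → ⊥-elim (<-irrefl e a) })
... | inj₁ a | inj₂ b rewrite rotate₁-< M i a | rotate₁-≡ M j b = mk⇔
  (λ { (inj₁ ()) ; (inj₂ (e , _)) → inj₁ (suc-injective (trans e (sym b))) })
  (λ { (inj₁ e) → inj₂ (trans (cong suc e) b , refl) ; (inj₂ (e , _)) → ⊥-elim (<-irrefl e a) })
... | inj₂ a | inj₁ b rewrite rotate₁-≡ M i a | rotate₁-< M j b = mk⇔
  (λ { (inj₁ e) → inj₂ (a , suc-injective (sym e)) ; (inj₂ (e , _)) → ⊥-elim (3≤⇒1≢ 3≤M e) })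
  (λ { (inj₁ e) → ⊥-elim (<-irrefl refl (<-trans (n<1+n M) (subst (λ z → suc z < M) (trans (sym e) a) b)))
     ; (inj₂ (_ , e)) → inj₁ (cong suc (sym e)) })
... | inj₂ a | inj₂ b rewrite rotate₁-≡ M i a | rotate₁-≡ M j b = mk⇔
  (λ { (inj₁ ()) ; (inj₂ (e , _)) → ⊥-elim (3≤⇒1≢ 3≤M e) })
  (λ { (inj₁ e) → ⊥-elim (1+n≰n (≤-reflexive (trans e (suc-injective (trans b (sym a))))))
     ; (inj₂ (e , j≡0)) → ⊥-elim (3≤⇒1≢ 3≤M (trans (cong suc (sym j≡0)) b)) })

rotate₁-symmetry : ∀ M → 3 ≤ M → CycleSymmetry M (rotate₁ M)
rotate₁-symmetry M 3≤M = record
  { range      = range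
  ; injective  = injective
  ; surjective = surjective
  ; adjacent   = CycSucc-preserved⇒CycAdjacent (rotate₁ M) (rotate₁-CycSucc M 3≤M)
  }
  where
  range : ∀ i → i < M → rotate₁ M i < M
  range i hi with m≤n⇒m<n∨m≡n hi
  ... | inj₁ a rewrite rotate₁-< M i a = a
  ... | inj₂ a rewrite rotate₁-≡ M i a = ≤-trans (s≤s z≤n) hi
  injective : ∀ i j → i < M → j < M → rotate₁ M i ≡ rotate₁ M j → i ≡ j
  injective i j hi hj e with m≤n⇒m<n∨m≡n hi | m≤n⇒m<n∨m≡n hj
  ... | inj₁ a | inj₁ b rewrite rotate₁-< M i a | rotate₁-< M j b = suc-injective e
  ... | inj₁ a | inj₂ b rewrite rotate₁-< M i a | rotate₁-≡ M j b = ⊥-elim (1+n≢0 e)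
  ... | inj₂ a | inj₁ b rewrite rotate₁-≡ M i a | rotate₁-< M j b = ⊥-elim (1+n≢0 (sym e))
  ... | inj₂ a | inj₂ b = suc-injective (trans a (sym b))
  surjective : ∀ j → j < M → Σ ℕ λ i → i < M × rotate₁ M i ≡ j
  surjective zero    h = let (i , 1+i≡M) = last-index h in
    i , subst (suc i ≤_) 1+i≡M ≤-refl , rotate₁-≡ M i 1+i≡M
  surjective (suc j) h = j , <-trans (n<1+n j) h , rotate₁-< M j h

rotation : ℕ → ℕ → ℕ → ℕ
rotation M zero    = λ i → i
rotation M (suc k) = rotate₁ M ∘ rotation M k

rotation-0 : ∀ M k → k < M → rotation M k 0 ≡ k
rotation-0 M zero    _ = refl
rotation-0 M (suc k) h = trans (cong (rotate₁ M) (rotation-0 M k (<-trans (n<1+n k) h))) (rotate₁-< M k h)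

rotation-symmetry : ∀ M k → 3 ≤ M → CycleSymmetry M (rotation M k)
rotation-symmetry M zero    3≤M = record
  { range = λ i h → h ; injective = λ i j _ _ e → e ; surjective = λ j h → j , h , refl
  ; adjacent = λ i j _ _ → ⇔.refl }
rotation-symmetry M (suc k) 3≤M = CycleSymmetry-∘ (rotate₁-symmetry M 3≤M) (rotation-symmetry M k 3≤M)

reflect : ℕ → ℕ → ℕ
reflect M zero    = zero
reflect M (suc i) = M ∸ suc i

suc[m∸[1+n]]≡m∸n : ∀ m n → suc n ≤ m → suc (m ∸ suc n) ≡ m ∸ n
suc[m∸[1+n]]≡m∸n m n h = sym (+-∸-assoc 1 h)

reflect-CycSucc : ∀ M → 3 ≤ M → ∀ i j → i < M → j < M →
                  CycSucc M (reflect M i) (reflect M j) ⇔ CycSucc M j i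
reflect-CycSucc M 3≤M zero    zero    _  _  = ⇔.refl
reflect-CycSucc M 3≤M zero    (suc j) _  hj = mk⇔
  (λ { (inj₁ e) → inj₂ (trans (cong (_+ suc j) e) (m∸n+n≡m (<⇒≤ hj)) , refl)
     ; (inj₂ (e , _)) → ⊥-elim (3≤⇒1≢ 3≤M e) })
  (λ { (inj₁ ()) ; (inj₂ (e , _)) → inj₁ (sym (subst (λ z → z ∸ suc j ≡ 1) e (m+n∸n≡m 1 (suc j)))) })
reflect-CycSucc M 3≤M (suc i) zero    hi _  = mk⇔
  (λ { (inj₁ ())
     ; (inj₂ (e , _)) → inj₁ (sym (+-cancelˡ-≡ (M ∸ suc i) (suc i) 1
          (trans (m∸n+n≡m (<⇒≤ hi)) (trans (sym e) (+-comm 1 (M ∸ suc i)))))) })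
  (λ { (inj₁ refl) → inj₂ (suc[m∸[1+n]]≡m∸n M 0 (≤-trans (s≤s z≤n) 3≤M) , refl)
     ; (inj₂ (e , _)) → ⊥-elim (3≤⇒1≢ 3≤M e) })
reflect-CycSucc M 3≤M (suc i) (suc j) hi hj = mk⇔
  (λ { (inj₁ e) → inj₁ (sym (∸-cancelˡ-≡ (<⇒≤ hi) hj
                      (suc-injective (trans e (sym (suc[m∸[1+n]]≡m∸n M (suc j) hj))))))
     ; (inj₂ (_ , e)) → ⊥-elim (m>n⇒m∸n≢0 hj e) })
  (λ { (inj₁ e) → inj₁ (subst (λ z → suc (M ∸ z) ≡ M ∸ suc j) e (suc[m∸[1+n]]≡m∸n M (suc j) hj))
     ; (inj₂ (_ , ())) })

reflect-symmetry : ∀ M → 3 ≤ M → CycleSymmetry M (reflect M)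
reflect-symmetry M 3≤M = record
  { range      = range
  ; injective  = injective
  ; surjective = surjective
  ; adjacent   = CycSucc-reversed⇒CycAdjacent (reflect M) (reflect-CycSucc M 3≤M)
  }
  where
  range : ∀ i → i < M → reflect M i < M
  range zero    h = h
  range (suc i) h = ∸-monoʳ-< {o = 0} (s≤s z≤n) (<⇒≤ h)
  injective : ∀ i j → i < M → j < M → reflect M i ≡ reflect M j → i ≡ j
  injective zero    zero    _  _  _ = refl
  injective zero    (suc j) _  hj e = ⊥-elim (m>n⇒m∸n≢0 hj (sym e))
  injective (suc i) zero    hi _  e = ⊥-elim (m>n⇒m∸n≢0 hi e)
  injective (suc i) (suc j) hi hj e = ∸-cancelˡ-≡ (<⇒≤ hi) (<⇒≤ hj) e
  surjective : ∀ j → j < M → Σ ℕ λ i → i < M × reflect M i ≡ j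
  surjective zero    h = 0 , h , refl
  surjective (suc j) h with M ∸ suc j in eq
  ... | zero  = ⊥-elim (m>n⇒m∸n≢0 h eq)
  ... | suc k = suc k , subst (_< M) eq (range (suc j) h) , trans (cong (M ∸_) (sym eq)) (m∸[m∸n]≡n (<⇒≤ h))

Agrees : ∀ {n} → ℕ → (ℕ → Fin n) → ℕ → (ℕ → Fin n) → Set
Agrees L q M g = ∀ i → i < L → i < M × g i ≡ q i

-- q (i + 2) sits at a cycle-neighbour of position i + 1; that is neither i nor 0,
-- since q is injective and g agrees with q there, so it is i + 2.
agree-step : ∀ {n L M} {H : Graph n} {g q : ℕ → Fin n} → InducedCycleOn H M g → InducedOn H L q Adjacent →
  Occurs L q M g → g 0 ≡ q 0 → ∀ i → suc (suc i) < L →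
  i < M × g i ≡ q i → suc i < M × g (suc i) ≡ q (suc i) → suc (suc i) < M × g (suc (suc i)) ≡ q (suc (suc i))
agree-step {L = L} {M} {H} {g} {q} (_ , induced _ _ g-edge) (induced _ q-inj q-edge) occ g0≡q0 i h
           (hi , gi≡qi) (hi' , gi'≡qi')
  with occ (suc (suc i)) h
... | j , hj , gj≡q with to (g-edge (suc i) j hi' hj)
       (subst₂ (E H) (sym gi'≡qi') (sym gj≡q)
         (from (q-edge (suc i) (suc (suc i)) (<-trans (n<1+n _) h) h) (inj₁ refl)))
... | inj₁ (inj₁ refl)       = hj , gj≡q
... | inj₁ (inj₂ (_ , refl)) =
  ⊥-elim (1+n≢0 (sym (q-inj 0 (suc (suc i)) (≤-trans (s≤s z≤n) h) h (trans (sym g0≡q0) gj≡q))))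
... | inj₂ (inj₁ refl)       = ⊥-elim (<-irrefl (q-inj i (suc (suc i)) (<-trans (n<1+n _) (<-trans (n<1+n _) h)) h
                                 (trans (sym gi≡qi) gj≡q)) (<-trans (n<1+n i) (n<1+n (suc i))))
... | inj₂ (inj₂ (_ , ()))

agree-from-first-two : ∀ {n L M} {H : Graph n} {g q : ℕ → Fin n} →
  InducedCycleOn H M g → InducedOn H L q Adjacent → Occurs L q M g → g 0 ≡ q 0 → g 1 ≡ q 1 → Agrees L q M g
agree-from-first-two {L = L} {M} {g = g} {q} g-cycle@(3≤M , _) q-path occ g0≡q0 g1≡q1 = agrees
  where
  pairs : ∀ i → suc i < L → (i < M × g i ≡ q i) × (suc i < M × g (suc i) ≡ q (suc i))
  pairs zero    _ = (≤-trans (s≤s z≤n) 3≤M , g0≡q0) , (≤-trans (s≤s (s≤s z≤n)) 3≤M , g1≡q1)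
  pairs (suc i) h = let (p , p') = pairs i (<-trans (n<1+n _) h) in
    p' , agree-step g-cycle q-path occ g0≡q0 i h p p'
  agrees : Agrees L q M g
  agrees zero    _ = ≤-trans (s≤s z≤n) 3≤M , g0≡q0
  agrees (suc i) h = proj₂ (pairs i h)

-- q 1 is a cycle-neighbour of position 0: position 1 as wanted, or position M - 1,
-- which a reflection (fixing 0) moves to 1.
align-from-0 : ∀ {n L M} {H : Graph n} {g q : ℕ → Fin n} → InducedCycleOn H M g → InducedOn H L q Adjacent →
  2 ≤ L → Occurs L q M g → g 0 ≡ q 0 → Σ (ℕ → Fin n) λ g' → InducedCycleOn H M g' × Agrees L q M g'
align-from-0 {L = L} {M} {H} {g} {q} g-cycle@(3≤M , induced _ _ g-edge) q-path 2≤L occ g0≡q0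
  with occ 1 2≤L
... | j , hj , gj≡q1
  with to (g-edge 0 j (≤-trans (s≤s z≤n) 3≤M) hj)
          (subst₂ (E H) (sym g0≡q0) (sym gj≡q1)
            (from (InducedOn.edge q-path 0 1 (≤-trans (s≤s z≤n) 2≤L) 2≤L) (inj₁ refl)))
... | inj₁ (inj₁ refl)     = g , g-cycle , agree-from-first-two g-cycle q-path occ g0≡q0 gj≡q1
... | inj₁ (inj₂ (e , _))  = ⊥-elim (3≤⇒1≢ 3≤M e)
... | inj₂ (inj₁ ())
... | inj₂ (inj₂ (e , _))  = g ∘ reflect M , reflected , agree-from-first-two reflected q-path
  (relabel-Occurs (reflect-symmetry M 3≤M) occ) g0≡q0 (trans (cong (λ k → g (k ∸ 1)) (sym e)) gj≡q1)
  where reflected = relabel-cycle (reflect-symmetry M 3≤M) g-cycle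

align-cycle : ∀ {n L M} {H : Graph n} {f q : ℕ → Fin n} → InducedCycleOn H M f → InducedOn H L q Adjacent →
  2 ≤ L → Occurs L q M f → Σ (ℕ → Fin n) λ g → InducedCycleOn H M g × Agrees L q M g
align-cycle {M = M} {f = f} f-cycle@(3≤M , _) q-path 2≤L occ =
  let (j , hj , fj≡q0) = occ 0 (≤-trans (s≤s z≤n) 2≤L) ; ρ = rotation-symmetry M j 3≤M in
  align-from-0 (relabel-cycle ρ f-cycle) q-path 2≤L (relabel-Occurs ρ occ)
    (trans (cong f (rotation-0 M j hj)) fj≡q0)

-- Cutting a cycle along a path it contains

ClosingEdge : ℕ → ℕ → ℕ → ℕ → Set
ClosingEdge L t i j = (suc i ≡ L × j ≡ 0) ⊎ (i ≡ 0 × suc j ≡ t)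

-- r, on positions [0, t), closes the path q on positions [0, L) into the cycle q ++ r:
-- the only edges between them are q (L - 1) r 0 and q 0 r (t - 1).
record ClosingPath {n} (H : Graph n) (q : ℕ → Fin n) (L : ℕ) (r : ℕ → Fin n) (t : ℕ) : Set where
  field
    path     : InducedOn H t r Adjacent
    disjoint : ∀ i j → i < L → j < t → r j ≢ q i
    link     : ∀ i j → i < L → j < t → E H (q i) (r j) ⇔ ClosingEdge L t i j
    link˘    : ∀ i j → i < L → j < t → E H (r j) (q i) ⇔ ClosingEdge L t i j

CycSucc-shift : ∀ L t j j' → 1 ≤ L → CycSucc (L + t) (L + j) (L + j') ⇔ (suc j ≡ j')
CycSucc-shift L t j j' 1≤L = mk⇔
  (λ { (inj₁ e) → +-cancelˡ-≡ L (suc j) j' (trans (+-suc L j) e)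
     ; (inj₂ (_ , e)) → ⊥-elim (<-irrefl (sym (m+n≡0⇒m≡0 L e)) 1≤L) })
  (λ e → inj₁ (trans (sym (+-suc L j)) (cong (L +_) e)))

CycAdjacent-shift : ∀ L t j j' → 1 ≤ L → CycAdjacent (L + t) (L + j) (L + j') ⇔ Adjacent j j'
CycAdjacent-shift L t j j' 1≤L = CycSucc-shift L t j j' 1≤L ⊎-⇔ CycSucc-shift L t j' j 1≤L

CycSucc-into : ∀ L t i j → i < L → CycSucc (L + t) i (L + j) ⇔ (suc i ≡ L × j ≡ 0)
CycSucc-into L t i j hi = mk⇔
  (λ { (inj₁ e) → trans e (trans (cong (L +_) (j≡0 e)) (+-identityʳ L)) , j≡0 e
     ; (inj₂ (_ , e)) → ⊥-elim (<-irrefl (sym (m+n≡0⇒m≡0 L e)) (≤-trans (s≤s z≤n) hi)) })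
  (λ { (e , refl) → inj₁ (trans e (sym (+-identityʳ L))) })
  where
  j≡0 : suc i ≡ L + j → j ≡ 0
  j≡0 e = n≤0⇒n≡0 (+-cancelˡ-≤ L j 0 (subst (L + j ≤_) (sym (+-identityʳ L)) (subst (_≤ L) e hi)))

CycSucc-out : ∀ L t i j → i < L → CycSucc (L + t) (L + j) i ⇔ (i ≡ 0 × suc j ≡ t)
CycSucc-out L t i j hi = mk⇔
  (λ { (inj₁ e) → ⊥-elim (<-irrefl refl
                   (<-≤-trans hi (≤-trans (m≤m+n L j) (≤-trans (n≤1+n _) (≤-reflexive e)))))
     ; (inj₂ (e , i≡0)) → i≡0 , +-cancelˡ-≡ L (suc j) t (trans (+-suc L j) e) })
  (λ { (i≡0 , e) → inj₂ (trans (sym (+-suc L j)) (cong (L +_) e) , i≡0) })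

CycAdjacent-across : ∀ L t i j → i < L → CycAdjacent (L + t) i (L + j) ⇔ ClosingEdge L t i j
CycAdjacent-across L t i j hi = CycSucc-into L t i j hi ⊎-⇔ CycSucc-out L t i j hi

CycAdjacent-across˘ : ∀ L t i j → i < L → CycAdjacent (L + t) (L + j) i ⇔ ClosingEdge L t i j
CycAdjacent-across˘ L t i j hi = ⇔.trans ⇔-swap (CycAdjacent-across L t i j hi)

CycSucc-inner : ∀ L t i j → i < L → 1 ≤ t → CycSucc (L + t) i j ⇔ (suc i ≡ j)
CycSucc-inner L t i j hi 1≤t = mk⇔
  (λ { (inj₁ e) → e
     ; (inj₂ (e , _)) → ⊥-elim (<-irrefl refl (<-≤-trans (m<m+n L 1≤t) (subst (_≤ L) e hi))) })
  inj₁

CycAdjacent-inner : ∀ L t i j → i < L → j < L → 1 ≤ t → CycAdjacent (L + t) i j ⇔ Adjacent i j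
CycAdjacent-inner L t i j hi hj 1≤t = CycSucc-inner L t i j hi 1≤t ⊎-⇔ CycSucc-inner L t j i hj 1≤t

split-cycle : ∀ {n L t} {H : Graph n} {g q : ℕ → Fin n} → InducedCycleOn H (L + t) g → 1 ≤ L →
  (∀ i → i < L → g i ≡ q i) → ClosingPath H q L (λ j → g (L + j)) t
split-cycle {L = L} {t} {H} {g} (_ , induced vertex injective edge) 1≤L g≡q = record
  { path     = induced
      (λ j h → vertex _ (+-monoʳ-< L h))
      (λ j j' h h' e → +-cancelˡ-≡ L j j' (injective _ _ (+-monoʳ-< L h) (+-monoʳ-< L h') e))
      (λ j j' h h' → ⇔.trans (edge _ _ (+-monoʳ-< L h) (+-monoʳ-< L h')) (CycAdjacent-shift L t j j' 1≤L))
  ; disjoint = λ i j hi hj e → <-irrefl refl (<-≤-trans hi (≤-trans (m≤m+n L j)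
      (≤-reflexive (injective _ _ (+-monoʳ-< L hj) (inner hi) (trans e (sym (g≡q i hi)))))))
  ; link     = λ i j hi hj → subst (λ z → E H z (g (L + j)) ⇔ ClosingEdge L t i j) (g≡q i hi)
      (⇔.trans (edge _ _ (inner hi) (+-monoʳ-< L hj)) (CycAdjacent-across L t i j hi))
  ; link˘    = λ i j hi hj → subst (λ z → E H (g (L + j)) z ⇔ ClosingEdge L t i j) (g≡q i hi)
      (⇔.trans (edge _ _ (+-monoʳ-< L hj) (inner hi)) (CycAdjacent-across˘ L t i j hi))
  }
  where
  inner : ∀ {i} → i < L → i < L + t
  inner h = ≤-trans h (m≤m+n L t)

-- With t = 0 the cycle makes q (L - 1) adjacent to q 0, which fails on an induced path of L ≥ 3 vertices.
closing-nonempty : ∀ {n L t} {H : Graph n} {g q : ℕ → Fin n} → InducedCycleOn H (L + t) g → 1 ≤ L →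
  (∀ i → i < L → g i ≡ q i) → InducedOn H L q Adjacent → 1 ≤ t
closing-nonempty {t = suc t} _ _ _ _ = s≤s z≤n
closing-nonempty {L = suc L} {t = zero} {H} (3≤L , induced _ _ g-edge) 1≤L g≡q (induced _ _ q-edge)
  with to (q-edge L 0 ≤-refl 1≤L) (subst₂ (E H) (g≡q L ≤-refl) (g≡q 0 1≤L)
         (from (g-edge L 0 (≤-trans ≤-refl (m≤m+n (suc L) 0)) (≤-trans 1≤L (m≤m+n (suc L) 0)))
               (inj₁ (inj₂ (sym (+-identityʳ (suc L)) , refl)))))
... | inj₁ ()
... | inj₂ refl with 3≤L
...   | s≤s (s≤s ())

join : ∀ {n} → ℕ → (ℕ → Fin n) → (ℕ → Fin n) → ℕ → Fin n
join L q r i with i <? L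
... | yes _ = q i
... | no  _ = r (i ∸ L)

join-< : ∀ {n} L (q r : ℕ → Fin n) i → i < L → join L q r i ≡ q i
join-< L q r i h with i <? L
... | yes _ = refl
... | no ¬h = ⊥-elim (¬h h)

join-+ : ∀ {n} L (q r : ℕ → Fin n) j → join L q r (L + j) ≡ r j
join-+ L q r j with L + j <? L
... | yes h = ⊥-elim (<-irrefl refl (<-≤-trans h (m≤m+n L j)))
... | no  _ = cong r (m+n∸m≡n L j)

data Side (L t : ℕ) : ℕ → Set where
  left  : ∀ {i} → i < L → Side L t i
  right : ∀ {j} → j < t → Side L t (L + j)

side : ∀ L t i → i < L + t → Side L t i
side L t i h with i <? L
... | yes i<L = left i<L
... | no  i≮L =
  subst (Side L t) L+[i∸L]≡i (right (+-cancelˡ-< L (i ∸ L) t (subst (_< L + t) (sym L+[i∸L]≡i) h)))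
  where L+[i∸L]≡i = m+[n∸m]≡n (≮⇒≥ i≮L)

join-cycle : ∀ {n L t} {H : Graph n} {q r : ℕ → Fin n} → InducedOn H L q Adjacent → 2 ≤ L → 1 ≤ t →
  ClosingPath H q L r t → InducedCycleOn H (L + t) (join L q r)
join-cycle {L = L} {t} {H} {q} {r} (induced q-vertex q-inj q-edge) 2≤L 1≤t closing =
  +-mono-≤ 2≤L 1≤t , induced vertex injective edge
  where
  open ClosingPath closing renaming (path to r-path)
  open InducedOn r-path renaming (vertex to r-vertex; injective to r-inj; edge to r-edge)
  vertex : ∀ i → i < L + t → V H (join L q r i)
  vertex i h with side L t i h
  ... | left a         = subst (V H) (sym (join-< L q r i a)) (q-vertex i a)
  ... | right {i'} a   = subst (V H) (sym (join-+ L q r i')) (r-vertex i' a)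
  injective : ∀ i j → i < L + t → j < L + t → join L q r i ≡ join L q r j → i ≡ j
  injective i j hi hj e with side L t i hi | side L t j hj
  ... | left a       | left b       rewrite join-< L q r i a | join-< L q r j b = q-inj i j a b e
  ... | left a       | right {j'} b rewrite join-< L q r i a | join-+ L q r j' = ⊥-elim (disjoint i j' a b (sym e))
  ... | right {i'} a | left b       rewrite join-+ L q r i' | join-< L q r j b = ⊥-elim (disjoint j i' b a e)
  ... | right {i'} a | right {j'} b rewrite join-+ L q r i' | join-+ L q r j' = cong (L +_) (r-inj i' j' a b e)
  edge : ∀ i j → i < L + t → j < L + t → E H (join L q r i) (join L q r j) ⇔ CycAdjacent (L + t) i j
  edge i j hi hj with side L t i hi | side L t j hj
  ... | left a       | left b       rewrite join-< L q r i a | join-< L q r j b =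
    ⇔.trans (q-edge i j a b) (⇔.sym (CycAdjacent-inner L t i j a b 1≤t))
  ... | left a       | right {j'} b rewrite join-< L q r i a | join-+ L q r j' =
    ⇔.trans (link i j' a b) (⇔.sym (CycAdjacent-across L t i j' a))
  ... | right {i'} a | left b       rewrite join-+ L q r i' | join-< L q r j b =
    ⇔.trans (link˘ j i' b a) (⇔.sym (CycAdjacent-across˘ L t j i' b))
  ... | right {i'} a | right {j'} b rewrite join-+ L q r i' | join-+ L q r j' =
    ⇔.trans (r-edge i' j' a b) (⇔.sym (CycAdjacent-shift L t i' j' (≤-trans (s≤s z≤n) 2≤L)))

length-≤ : ∀ {L M} → 1 ≤ L → (∀ i → i < L → i < M) → L ≤ M
length-≤ {suc L} _ below = below L ≤-refl

InInducedCycle⇒ClosingPath : ∀ {n L} {H : Graph n} (d : Fin n) (v : Vec (Fin n) L) →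
  InducedOn H L (lookupOr d v) Adjacent → 2 ≤ L → InInducedCycle H v →
  Σ ℕ λ t → Σ (ℕ → Fin n) λ r → 1 ≤ t × ClosingPath H (lookupOr d v) L r t
InInducedCycle⇒ClosingPath d v v-path 2≤L v-in-cycle
  with InInducedCycle⇒InducedCycleOn d v v-in-cycle
... | M , f , f-cycle , occ with align-cycle f-cycle v-path 2≤L occ
... | g , g-cycle , agrees
  with m≤n⇒∃[o]m+o≡n (length-≤ (≤-trans (s≤s z≤n) 2≤L) (λ i h → proj₁ (agrees i h)))
... | t , refl = t , (λ j → g (_ + j)) ,
  closing-nonempty g-cycle 1≤L g≡v v-path , split-cycle g-cycle 1≤L g≡v
  where
  1≤L = ≤-trans (s≤s z≤n) 2≤L
  g≡v = λ i h → proj₂ (agrees i h)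

ClosingPath⇒InInducedCycle : ∀ {n L t} {H : Graph n} {r : ℕ → Fin n} (d : Fin n) (v : Vec (Fin n) L) →
  InducedOn H L (lookupOr d v) Adjacent → 2 ≤ L → 1 ≤ t → ClosingPath H (lookupOr d v) L r t →
  InInducedCycle H v
ClosingPath⇒InInducedCycle {L = L} {t} {r = r} d v v-path 2≤L 1≤t closing =
  InducedCycleOn⇒InInducedCycle d v (join L (lookupOr d v) r) (join-cycle v-path 2≤L 1≤t closing)
    (m≤m+n L t) (join-< L (lookupOr d v) r)

-- Contracting P to the edge xy

-- Positions of a, x, y, b inside the path a, P, b, where P has 3 + m vertices.
embed : ℕ → ℕ → ℕ
embed m 0                   = 0
embed m 1                   = 1
embed m 2                   = 3 + m
embed m (suc (suc (suc _))) = 4 + m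

-- A left inverse of embed m on [0, 4), which moreover sends suc (embed m k) to suc k.
unembed : ℕ → ℕ → ℕ
unembed m 0             = 0
unembed m 1             = 1
unembed m (suc (suc j)) = 2 + (j ∸ suc m)

data Below4 : ℕ → Set where
  #0 : Below4 0
  #1 : Below4 1
  #2 : Below4 2
  #3 : Below4 3

below4 : ∀ {k} → k < 4 → Below4 k
below4 {0} _ = #0
below4 {1} _ = #1
below4 {2} _ = #2
below4 {3} _ = #3
below4 {suc (suc (suc (suc _)))} (s≤s (s≤s (s≤s (s≤s ()))))

1<4 : 1 < 4
1<4 = s≤s (s≤s z≤n)

2<4 : 2 < 4
2<4 = s≤s (s≤s (s≤s z≤n))

embed-< : ∀ m k → k < 4 → embed m k < 5 + m
embed-< m k h with below4 h
... | #0 = s≤s z≤n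
... | #1 = s≤s (s≤s z≤n)
... | #2 = <-trans (n<1+n (3 + m)) (n<1+n (4 + m))
... | #3 = ≤-refl

unembed-embed : ∀ m k → k < 4 → unembed m (embed m k) ≡ k
unembed-embed m k h with below4 h
... | #0 = refl
... | #1 = refl
... | #2 = cong (2 +_) (n∸n≡0 m)
... | #3 = cong (2 +_) (m+n∸n≡m 1 m)

unembed-suc-embed : ∀ m k → k < 4 → unembed m (suc (embed m k)) ≡ suc k
unembed-suc-embed m k h with below4 h
... | #0 = refl
... | #1 = refl
... | #2 = cong (2 +_) (m+n∸n≡m 1 m)
... | #3 = cong (2 +_) (m+n∸n≡m 2 m)

embed-injective : ∀ m k l → k < 4 → l < 4 → embed m k ≡ embed m l → k ≡ l
embed-injective m k l hk hl e = begin
  k                       ≡⟨ unembed-embed m k hk ⟨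
  unembed m (embed m k)   ≡⟨ cong (unembed m) e ⟩
  unembed m (embed m l)   ≡⟨ unembed-embed m l hl ⟩
  l                       ∎
  where open ≡-Reasoning

embed-reflects-Adjacent : ∀ m k l → k < 4 → l < 4 → Adjacent (embed m k) (embed m l) → Adjacent k l
embed-reflects-Adjacent m k l hk hl = Sum.map (reflect-suc k l hk hl) (reflect-suc l k hl hk)
  where
  reflect-suc : ∀ k l → k < 4 → l < 4 → suc (embed m k) ≡ embed m l → suc k ≡ l
  reflect-suc k l hk hl e =
    trans (sym (unembed-suc-embed m k hk)) (trans (cong (unembed m) e) (unembed-embed m l hl))

embed-ClosingEdge : ∀ m t k j → k < 4 → ClosingEdge (5 + m) t (embed m k) j ⇔ ClosingEdge 4 t k j
embed-ClosingEdge m t k j hk = (is-last ×-⇔ ⇔.refl) ⊎-⇔ (is-first ×-⇔ ⇔.refl)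
  where
  is-last : suc (embed m k) ≡ 5 + m ⇔ suc k ≡ 4
  is-last = mk⇔ (λ e → cong suc (embed-injective m k 3 hk ≤-refl (suc-injective e)))
                (λ e → cong (suc ∘ embed m) (suc-injective e))
  is-first : embed m k ≡ 0 ⇔ k ≡ 0
  is-first = mk⇔ (embed-injective m k 0 hk (s≤s z≤n)) (cong (embed m))

module Reduction {n} (G : Graph n) (simple : IsSimple G) (m : ℕ) (p : Vec (Fin n) (3 + m))
                 (p-path : IsInducedPath G p) where

  open IsSimple simple using (E-sym)

  K : ℕ
  K = 3 + m

  -- ext a p b has length suc (K + 1), which is 5 + m only propositionally.
  K+2≡5+m : suc (K + 1) ≡ 5 + m
  K+2≡5+m = cong suc (+-comm K 1)

  x y : Fin n
  x = head p
  y = last p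

  P : ℕ → Fin n
  P = lookupOr x p

  G' : Graph n
  G' = G+xy-I G p

  P-path : InducedOn G K P Adjacent
  P-path = InducedVec⇒InducedOn x p p-path

  open InducedOn P-path renaming (vertex to P-vertex; injective to P-injective; edge to P-edge)

  x≡P0 : x ≡ P 0
  x≡P0 = head≡lookupOr x p

  y≡Plast : y ≡ P (2 + m)
  y≡Plast = last≡lookupOr x p

  E'-sym : ∀ {u v} → E G' u v → E G' v u
  E'-sym (u∈ , v∈ , inj₁ e)               = v∈ , u∈ , inj₁ (E-sym e)
  E'-sym (u∈ , v∈ , inj₂ (inj₁ (e , e'))) = v∈ , u∈ , inj₂ (inj₂ (e' , e))
  E'-sym (u∈ , v∈ , inj₂ (inj₂ (e , e'))) = v∈ , u∈ , inj₂ (inj₁ (e' , e))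

  IsInternal : ℕ → Set
  IsInternal i = 1 ≤ i × suc i < K

  internal<K : ∀ {i} → IsInternal i → i < K
  internal<K {i} (_ , i+1<K) = <-trans (n<1+n i) i+1<K

  Internal⇒position : ∀ {v} → Internal p v → Σ ℕ λ i → IsInternal i × P i ≡ v
  Internal⇒position (i , 1≤i , i+1<K , e) = toℕ i , (1≤i , i+1<K) , trans (sym (lookup≡lookupOr x p i)) e

  position⇒Internal : ∀ {i} → IsInternal i → Internal p (P i)
  position⇒Internal {i} (1≤i , i+1<K) = fromℕ< i<K ,
    subst (1 ≤_) (sym (toℕ-fromℕ< i<K)) 1≤i ,
    subst (λ z → suc z < K) (sym (toℕ-fromℕ< i<K)) i+1<K ,
    trans (lookup≡lookupOr x p _) (cong P (toℕ-fromℕ< i<K))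
    where i<K = <-trans (n<1+n i) i+1<K

  data PathPos : ℕ → Set where
    first    : PathPos 0
    final    : PathPos (2 + m)
    internal : ∀ {i} → IsInternal i → PathPos i

  pathPos : ∀ i → i < K → PathPos i
  pathPos zero    _ = first
  pathPos (suc i) h with suc (suc i) <? K
  ... | yes i+2<K = internal (s≤s z≤n , i+2<K)
  ... | no  i+2≮K rewrite ≤-antisym (≤-pred h) (≤-pred (≮⇒≥ i+2≮K)) = final

  internal-≢x : ∀ {i} → IsInternal i → P i ≢ x
  internal-≢x {i} (1≤i , i+1<K) e =
    <-irrefl (sym (P-injective i 0 (<-trans (n<1+n i) i+1<K) (s≤s z≤n) (trans e x≡P0))) 1≤i

  internal-≢y : ∀ {i} → IsInternal i → P i ≢ y
  internal-≢y {i} (1≤i , i+1<K) e =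
    <-irrefl (P-injective i (2 + m) (<-trans (n<1+n i) i+1<K) ≤-refl (trans e y≡Plast)) (≤-pred i+1<K)

  internal∈I : ∀ {i} → IsInternal i → IP G p (P i)
  internal∈I int = inj₁ (position⇒Internal int) , internal-≢x int , internal-≢y int

  -- Within V G, the vertices of G' other than x and y.
  Away : Fin n → Set
  Away w = ¬ IP G p w × w ≢ x × w ≢ y

  E'⇔E : ∀ {u v} → V G u → Away u → V G' v → E G' u v ⇔ E G u v
  E'⇔E u∈ (u∉I , u≢x , u≢y) v∈ = mk⇔ to' (λ e → (u∈ , u∉I) , v∈ , inj₁ e)
    where
    to' : E G' _ _ → E G _ _
    to' (_ , _ , inj₁ e)               = e
    to' (_ , _ , inj₂ (inj₁ (e , _))) = ⊥-elim (u≢x e)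
    to' (_ , _ , inj₂ (inj₂ (e , _))) = ⊥-elim (u≢y e)

  E'⇔E˘ : ∀ {u v} → V G' u → V G v → Away v → E G' u v ⇔ E G u v
  E'⇔E˘ u∈ v∈ v-away =
    ⇔.trans (mk⇔ E'-sym E'-sym) (⇔.trans (E'⇔E v∈ v-away u∈) (mk⇔ E-sym E-sym))

  Away⇒off-path : ∀ {w} → Away w → ∀ i → i < K → P i ≢ w
  Away⇒off-path (w∉I , w≢x , w≢y) i h e with pathPos i h
  ... | first        = w≢x (trans (sym e) (sym x≡P0))
  ... | final        = w≢y (trans (sym e) (sym y≡Plast))
  ... | internal int = w∉I (subst (IP G p) e (internal∈I int))

  Away⇒no-internal-edge : ∀ {w} → Away w → ∀ {i} → IsInternal i → ¬ E G (P i) w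
  Away⇒no-internal-edge (w∉I , w≢x , w≢y) int e = w∉I (inj₂ (_ , position⇒Internal int , e) , w≢x , w≢y)

  xy : Vec (Fin n) 2
  xy = x ∷ y ∷ []

  IsEnd : ℕ → Set
  IsEnd k = k ≡ 0 ⊎ k ≡ 3

  -- In a, P, b the ends sit at positions 0 and K + 1, the internal vertices at 2 … K - 1.
  end-far : ∀ {k i} → IsEnd k → IsInternal i → suc i ≢ embed m k × ¬ Adjacent (suc i) (embed m k)
  end-far (inj₁ refl) (1≤i , _) = (λ ()) , λ { (inj₁ ()) ; (inj₂ e) → <-irrefl (suc-injective e) 1≤i }
  end-far (inj₂ refl) int@(_ , i+1<K) =
    (λ e → <-irrefl (suc-injective e) (internal<K int)) ,
    λ { (inj₁ e) → <-irrefl (suc-injective e) i+1<K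
      ; (inj₂ e) → <-irrefl (sym (suc-injective e)) (<-trans (internal<K int) (n<1+n K)) }

  data ExtPos : ℕ → Set where
    outer : ∀ {k} → k < 4 → IsEnd k → ExtPos (embed m k)
    inner : ∀ {i} → i < K → ExtPos (suc i)

  extPos : ∀ i → i < 5 + m → ExtPos i
  extPos zero    _ = outer (s≤s z≤n) (inj₁ refl)
  extPos (suc i) h with suc i <? suc K
  ... | yes i+1≤K = inner (≤-pred i+1≤K)
  ... | no  i+1≰K rewrite ≤-antisym (≤-pred (≤-pred h)) (≤-pred (≮⇒≥ i+1≰K)) = outer ≤-refl (inj₂ refl)

  module Ends (a b : Fin n) where

    Q Q' : ℕ → Fin n
    Q  = lookupOr x (ext a p b)
    Q' = lookupOr x (ext a xy b)

    Q-inner : ∀ i → i < K → Q (suc i) ≡ P i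
    Q-inner i h = lookupOr-++ˡ x p (b ∷ []) i h

    Q-end : Q (suc K) ≡ b
    Q-end = subst (λ z → lookupOr x (p ++ (b ∷ [])) z ≡ b) (+-identityʳ K) (lookupOr-++ʳ x p (b ∷ []) 0)

    Q'≡Q∘embed : ∀ k → k < 4 → Q' k ≡ Q (embed m k)
    Q'≡Q∘embed k h with below4 h
    ... | #0 = refl
    ... | #1 = trans x≡P0 (sym (Q-inner 0 (s≤s z≤n)))
    ... | #2 = trans y≡Plast (sym (Q-inner (2 + m) ≤-refl))
    ... | #3 = sym Q-end

    IsInducedPath⇔InducedOn : IsInducedPath G (ext a p b) ⇔ InducedOn G (5 + m) Q Adjacent
    IsInducedPath⇔InducedOn = mk⇔
      (λ h → subst (λ L → InducedOn G L Q Adjacent) K+2≡5+m (InducedVec⇒InducedOn x (ext a p b) h))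
      (λ h → InducedOn⇒InducedVec Q (ext a p b) (lookup≡lookupOr x (ext a p b))
               (subst (λ L → InducedOn G L Q Adjacent) (sym K+2≡5+m) h))

    IsInducedPath⇔InducedOn' : IsInducedPath G' (ext a xy b) ⇔ InducedOn G' 4 Q' Adjacent
    IsInducedPath⇔InducedOn' = mk⇔
      (InducedVec⇒InducedOn x (ext a xy b))
      (InducedOn⇒InducedVec Q' (ext a xy b) (lookup≡lookupOr x (ext a xy b)))

    inner< : ∀ {i} → i < K → suc i < 5 + m
    inner< h = s≤s (≤-trans h (n≤1+n K))

    path⇒path' : InducedOn G (5 + m) Q Adjacent → InducedOn G' 4 Q' Adjacent
    path⇒path' (induced Q-vertex Q-injective Q-edge) = induced vertex' injective' edge'
      where
      Q'≡ : ∀ {k} (h : k < 4) → Q' k ≡ Q (embed m k)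
      Q'≡ {k} = Q'≡Q∘embed k

      end∉N[in] : ∀ {k} → k < 4 → IsEnd k → ¬ NClosed G (Internal p) (Q' k)
      end∉N[in] {k} hk end (inj₁ int) with Internal⇒position int
      ... | i , i-int , Pi≡ = proj₁ (end-far end i-int)
            (Q-injective _ _ (inner< (internal<K i-int)) (embed-< m k hk)
              (trans (Q-inner i (internal<K i-int)) (trans Pi≡ (Q'≡ hk))))
      end∉N[in] {k} hk end (inj₂ (_ , int , e)) with Internal⇒position int
      ... | i , i-int , refl = proj₂ (end-far end i-int)
            (to (Q-edge _ _ (inner< (internal<K i-int)) (embed-< m k hk))
                (subst₂ (E G) (sym (Q-inner i (internal<K i-int))) (Q'≡ hk) e))

      ∉I : ∀ k → k < 4 → ¬ IP G p (Q' k)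
      ∉I k h with below4 h
      ... | #0 = λ (nc , _) → end∉N[in] h (inj₁ refl) nc
      ... | #1 = λ (_ , x≢x , _) → x≢x refl
      ... | #2 = λ (_ , _ , y≢y) → y≢y refl
      ... | #3 = λ (nc , _) → end∉N[in] h (inj₂ refl) nc

      vertex' : ∀ k → k < 4 → V G' (Q' k)
      vertex' k h = subst (V G) (sym (Q'≡ h)) (Q-vertex _ (embed-< m k h)) , ∉I k h

      injective' : ∀ k l → k < 4 → l < 4 → Q' k ≡ Q' l → k ≡ l
      injective' k l hk hl e = embed-injective m k l hk hl
        (Q-injective _ _ (embed-< m k hk) (embed-< m l hl) (trans (sym (Q'≡ hk)) (trans e (Q'≡ hl))))

      embedded-edge : ∀ k l (hk : k < 4) (hl : l < 4) → Adjacent (embed m k) (embed m l) → E G' (Q' k) (Q' l)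
      embedded-edge k l hk hl adj = vertex' k hk , vertex' l hl ,
        inj₁ (subst₂ (E G) (sym (Q'≡ hk)) (sym (Q'≡ hl)) (from (Q-edge _ _ (embed-< m k hk) (embed-< m l hl)) adj))

      succ-edge : ∀ k → (hk : k < 4) (hl : suc k < 4) → E G' (Q' k) (Q' (suc k))
      succ-edge k hk hl with below4 hk
      ... | #0 = embedded-edge 0 1 hk hl (inj₁ refl)
      ... | #1 = vertex' 1 hk , vertex' 2 hl , inj₂ (inj₁ (refl , refl))
      ... | #2 = embedded-edge 2 3 hk hl (inj₁ refl)
      ... | #3 = ⊥-elim (<-irrefl refl hl)

      edge' : ∀ k l → k < 4 → l < 4 → E G' (Q' k) (Q' l) ⇔ Adjacent k l
      edge' k l hk hl = mk⇔ to' from'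
        where
        to' : E G' (Q' k) (Q' l) → Adjacent k l
        to' (_ , _ , inj₁ e) = embed-reflects-Adjacent m k l hk hl
          (to (Q-edge _ _ (embed-< m k hk) (embed-< m l hl)) (subst₂ (E G) (Q'≡ hk) (Q'≡ hl) e))
        to' (_ , _ , inj₂ (inj₁ (e₁ , e₂))) =
          subst₂ Adjacent (injective' 1 k 1<4 hk (sym e₁)) (injective' 2 l 2<4 hl (sym e₂)) (inj₁ refl)
        to' (_ , _ , inj₂ (inj₂ (e₁ , e₂))) =
          subst₂ Adjacent (injective' 2 k 2<4 hk (sym e₁)) (injective' 1 l 1<4 hl (sym e₂)) (inj₂ refl)
        from' : Adjacent k l → E G' (Q' k) (Q' l)
        from' (inj₁ refl) = succ-edge k hk hl
        from' (inj₂ refl) = E'-sym (succ-edge l hl hk)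

    end-≢1 : ∀ {k} → IsEnd k → k ≢ 1
    end-≢1 (inj₁ refl) ()
    end-≢1 (inj₂ refl) ()

    end-≢2 : ∀ {k} → IsEnd k → k ≢ 2
    end-≢2 (inj₁ refl) ()
    end-≢2 (inj₂ refl) ()

    end-Away : InducedOn G' 4 Q' Adjacent → ∀ {k} → k < 4 → IsEnd k → Away (Q' k)
    end-Away (induced vertex' injective' _) {k} hk end =
      proj₂ (vertex' k hk) ,
      (λ e → end-≢1 end (injective' k 1 hk 1<4 e)) ,
      (λ e → end-≢2 end (injective' k 2 hk 2<4 e))

    end-embed-Adjacent : ∀ {k l} → IsEnd k → l < 4 → Adjacent k l → Adjacent (embed m k) (embed m l)
    end-embed-Adjacent (inj₁ refl) _ (inj₁ refl) = inj₁ refl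
    end-embed-Adjacent (inj₂ refl) _ (inj₂ refl) = inj₂ refl
    end-embed-Adjacent (inj₂ refl) (s≤s (s≤s (s≤s (s≤s ())))) (inj₁ refl)

    path'⇒path : InducedOn G' 4 Q' Adjacent → InducedOn G (5 + m) Q Adjacent
    path'⇒path Q'-path@(induced vertex' injective' edge') = induced vertex injective edge
      where
      away : ∀ {k} → k < 4 → IsEnd k → Away (Q' k)
      away = end-Away Q'-path

      vertex : ∀ i → i < 5 + m → V G (Q i)
      vertex i h with extPos i h
      ... | outer {k} hk _ = subst (V G) (Q'≡Q∘embed k hk) (proj₁ (vertex' k hk))
      ... | inner {i} hi   = subst (V G) (sym (Q-inner i hi)) (P-vertex i hi)

      injective : ∀ i j → i < 5 + m → j < 5 + m → Q i ≡ Q j → i ≡ j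
      injective i j hi hj e with extPos i hi | extPos j hj
      ... | outer {k} hk _   | outer {l} hl _ =
        cong (embed m) (injective' k l hk hl (trans (Q'≡Q∘embed k hk) (trans e (sym (Q'≡Q∘embed l hl)))))
      ... | outer {k} hk end | inner {j} hj' =
        ⊥-elim (Away⇒off-path (away hk end) j hj'
          (trans (sym (Q-inner j hj')) (trans (sym e) (sym (Q'≡Q∘embed k hk)))))
      ... | inner {i} hi'    | outer {l} hl end =
        ⊥-elim (Away⇒off-path (away hl end) i hi' (trans (sym (Q-inner i hi')) (trans e (sym (Q'≡Q∘embed l hl)))))
      ... | inner {i} hi'    | inner {j} hj' =
        cong suc (P-injective i j hi' hj' (trans (sym (Q-inner i hi')) (trans e (Q-inner j hj'))))

      outer-edge : ∀ {k l} (hk : k < 4) (hl : l < 4) → IsEnd k →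
                   E G (Q (embed m k)) (Q (embed m l)) ⇔ Adjacent (embed m k) (embed m l)
      outer-edge {k} {l} hk hl end
        rewrite sym (Q'≡Q∘embed k hk) | sym (Q'≡Q∘embed l hl) = ⇔.trans
          (⇔.sym (E'⇔E (proj₁ (vertex' k hk)) (away hk end) (vertex' l hl)))
          (⇔.trans (edge' k l hk hl) (mk⇔ (end-embed-Adjacent end hl) (embed-reflects-Adjacent m k l hk hl)))

      outer-inner-edge : ∀ {k j} (hk : k < 4) → IsEnd k → j < K →
                         E G (Q (embed m k)) (Q (suc j)) ⇔ Adjacent (embed m k) (suc j)
      outer-inner-edge hk end hj with pathPos _ hj
      ... | first        = outer-edge hk 1<4 end
      ... | final        = outer-edge hk 2<4 end
      ... | internal int rewrite Q-inner _ hj = mk⇔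
        (λ e → ⊥-elim (Away⇒no-internal-edge (subst Away (Q'≡Q∘embed _ hk) (away hk end)) int (E-sym e)))
        (λ adj → ⊥-elim (proj₂ (end-far end int) (to Adjacent-sym adj)))

      edge : ∀ i j → i < 5 + m → j < 5 + m → E G (Q i) (Q j) ⇔ Adjacent i j
      edge i j hi hj with extPos i hi | extPos j hj
      ... | outer hk end | outer hl _   = outer-edge hk hl end
      ... | outer hk end | inner hj'    = outer-inner-edge hk end hj'
      ... | inner hi'    | outer hl end =
        ⇔.trans (mk⇔ E-sym E-sym) (⇔.trans (outer-inner-edge hl end hi') Adjacent-sym)
      ... | inner {i} hi' | inner {j} hj' rewrite Q-inner i hi' | Q-inner j hj' =
        ⇔.trans (P-edge i j hi' hj') Adjacent-suc

    module _ (Q'-path : InducedOn G' 4 Q' Adjacent) {r : ℕ → Fin n} {t : ℕ} where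

      open InducedOn Q'-path renaming (vertex to Q'-vertex)

      internal-not-ClosingEdge : ∀ {i j} → IsInternal i → ¬ ClosingEdge (5 + m) t (suc i) j
      internal-not-ClosingEdge int (inj₁ (e , _)) = <-irrefl (suc-injective (suc-injective e)) (internal<K int)
      internal-not-ClosingEdge _ (inj₂ (() , _))

      embedded-link : ∀ {k w} → k < 4 → V G w → Away w → E G (Q (embed m k)) w ⇔ E G' (Q' k) w
      embedded-link {k} hk w∈ w-away rewrite sym (Q'≡Q∘embed k hk) =
        ⇔.sym (E'⇔E˘ (Q'-vertex k hk) w∈ w-away)

      closing⇒closing' : ClosingPath G Q (5 + m) r t → ClosingPath G' Q' 4 r t
      closing⇒closing' c = record
        { path     = induced r∈G' r-injective
                       (λ j j' h h' → ⇔.trans (E'⇔E (r-vertex j h) (r-away j h) (r∈G' j' h')) (r-edge j j' h h'))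
        ; disjoint = disjoint'
        ; link     = link'
        ; link˘    = λ k j hk hj → ⇔.trans (mk⇔ E'-sym E'-sym) (link' k j hk hj)
        }
        where
        open ClosingPath c
        open InducedOn path renaming (vertex to r-vertex; injective to r-injective; edge to r-edge)
        disjoint' : ∀ k j → k < 4 → j < t → r j ≢ Q' k
        disjoint' k j hk hj e = disjoint (embed m k) j (embed-< m k hk) hj (trans e (Q'≡Q∘embed k hk))
        r∉I : ∀ j → j < t → ¬ IP G p (r j)
        r∉I j hj (inj₁ int , _) with Internal⇒position int
        ... | i , i-int , Pi≡rj =
          disjoint (suc i) j (inner< (internal<K i-int)) hj (sym (trans (Q-inner i (internal<K i-int)) Pi≡rj))
        r∉I j hj (inj₂ (_ , int , e) , _) with Internal⇒position int
        ... | i , i-int , refl = internal-not-ClosingEdge i-int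
          (to (link (suc i) j (inner< (internal<K i-int)) hj)
              (subst (λ z → E G z (r j)) (sym (Q-inner i (internal<K i-int))) e))
        r-away : ∀ j → j < t → Away (r j)
        r-away j hj = r∉I j hj , disjoint' 1 j 1<4 hj , disjoint' 2 j 2<4 hj
        r∈G' : ∀ j → j < t → V G' (r j)
        r∈G' j hj = r-vertex j hj , r∉I j hj
        link' : ∀ k j → k < 4 → j < t → E G' (Q' k) (r j) ⇔ ClosingEdge 4 t k j
        link' k j hk hj = ⇔.trans (⇔.sym (embedded-link hk (r-vertex j hj) (r-away j hj)))
          (⇔.trans (link (embed m k) j (embed-< m k hk) hj) (embed-ClosingEdge m t k j hk))

      closing'⇒closing : ClosingPath G' Q' 4 r t → ClosingPath G Q (5 + m) r t
      closing'⇒closing c' = record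
        { path     = induced (λ j h → proj₁ (r-vertex' j h)) r-injective
                       (λ j j' h h' → ⇔.trans (⇔.sym (E'⇔E (proj₁ (r-vertex' j h)) (r-away j h) (r-vertex' j' h')))
                                              (r-edge' j j' h h'))
        ; disjoint = disjoint
        ; link     = link
        ; link˘    = λ i j hi hj → ⇔.trans (mk⇔ E-sym E-sym) (link i j hi hj)
        }
        where
        open ClosingPath c' renaming (disjoint to disjoint'; link to link')
        open InducedOn path renaming (vertex to r-vertex'; injective to r-injective; edge to r-edge')
        r-away : ∀ j → j < t → Away (r j)
        r-away j hj = proj₂ (r-vertex' j hj) , disjoint' 1 j 1<4 hj , disjoint' 2 j 2<4 hj
        disjoint : ∀ i j → i < 5 + m → j < t → r j ≢ Q i
        disjoint i j hi hj e with extPos i hi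
        ... | outer {k} hk _ = disjoint' k j hk hj (trans e (sym (Q'≡Q∘embed k hk)))
        ... | inner {i} hi'  = Away⇒off-path (r-away j hj) i hi' (sym (trans e (Q-inner i hi')))
        embedded : ∀ k j → k < 4 → j < t → E G (Q (embed m k)) (r j) ⇔ ClosingEdge (5 + m) t (embed m k) j
        embedded k j hk hj = ⇔.trans (embedded-link hk (proj₁ (r-vertex' j hj)) (r-away j hj))
          (⇔.trans (link' k j hk hj) (⇔.sym (embed-ClosingEdge m t k j hk)))
        link : ∀ i j → i < 5 + m → j < t → E G (Q i) (r j) ⇔ ClosingEdge (5 + m) t i j
        link i j hi hj with extPos i hi
        ... | outer {k} hk _ = embedded k j hk hj
        ... | inner {i} hi' with pathPos i hi'
        ...   | first        = embedded 1 j 1<4 hj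
        ...   | final        = embedded 2 j 2<4 hj
        ...   | internal int rewrite Q-inner i hi' = mk⇔
          (λ e → ⊥-elim (Away⇒no-internal-edge (r-away j hj) int e))
          (λ ce → ⊥-elim (internal-not-ClosingEdge int ce))

    path⇔path' : IsInducedPath G (ext a p b) ⇔ IsInducedPath G' (ext a xy b)
    path⇔path' = ⇔.trans IsInducedPath⇔InducedOn
      (⇔.trans (mk⇔ path⇒path' path'⇒path) (⇔.sym IsInducedPath⇔InducedOn'))

    cycle⇔cycle' : IsInducedPath G (ext a p b) →
                   InInducedCycle G (ext a p b) ⇔ InInducedCycle G' (ext a xy b)
    cycle⇔cycle' ip = mk⇔ cycle⇒cycle' cycle'⇒cycle
      where
      Q-path : InducedOn G (suc (K + 1)) Q Adjacent
      Q-path = InducedVec⇒InducedOn x (ext a p b) ip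
      Q'-path : InducedOn G' 4 Q' Adjacent
      Q'-path = path⇒path' (to IsInducedPath⇔InducedOn ip)
      2≤K+2 : 2 ≤ suc (K + 1)
      2≤K+2 = s≤s (s≤s z≤n)

      cycle⇒cycle' : InInducedCycle G (ext a p b) → InInducedCycle G' (ext a xy b)
      cycle⇒cycle' c with InInducedCycle⇒ClosingPath x (ext a p b) Q-path 2≤K+2 c
      ... | t , r , 1≤t , closing = ClosingPath⇒InInducedCycle x (ext a xy b) Q'-path (s≤s (s≤s z≤n)) 1≤t
        (closing⇒closing' Q'-path (subst (λ L → ClosingPath G Q L r t) K+2≡5+m closing))

      cycle'⇒cycle : InInducedCycle G' (ext a xy b) → InInducedCycle G (ext a p b)
      cycle'⇒cycle c' with InInducedCycle⇒ClosingPath x (ext a xy b) Q'-path (s≤s (s≤s z≤n)) c'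
      ... | t , r , 1≤t , closing' = ClosingPath⇒InInducedCycle x (ext a p b) Q-path 2≤K+2 1≤t
        (subst (λ L → ClosingPath G Q L r t) (sym K+2≡5+m) (closing'⇒closing Q'-path closing'))

  open Ends

  avoidable⇔ : Avoidable G p ⇔ AvoidableEdge G' x y
  avoidable⇔ = simplicial⇔ ⊎-⇔ mk⇔
    (λ h a b ip' → let ip = from (path⇔path' a b) ip' in to (cycle⇔cycle' a b ip) (h a b ip))
    (λ h a b ip → from (cycle⇔cycle' a b ip) (h a b (to (path⇔path' a b) ip)))
    where
    simplicial⇔ : Simplicial G p ⇔ Simplicial G' xy
    simplicial⇔ = mk⇔
      (λ s (a , b , ip') → s (a , b , from (path⇔path' a b) ip'))
      (λ s (a , b , ip) → s (a , b , to (path⇔path' a b) ip))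

lemma32 : ∀ {n : ℕ} (G : Graph n) → IsSimple G →
    (m : ℕ) (p : Vec (Fin n) (3 + m)) → IsInducedPath G p →
    (Avoidable G p → AvoidableEdge (G+xy-I G p) (head p) (last p)) ×
    (AvoidableEdge (G+xy-I G p) (head p) (last p) → Avoidable G p)
lemma32 G simple m p p-path = to avoidable⇔ , from avoidable⇔
  where open Reduction G simple m p p-path
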